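{- Let $G$ be a finite connected graph and $\rho$ a parallelogram placement of $G$, and let $T$ be a spanning tree of $G$. For $e\in E_G\setminus E_T$ let $C^T_e$ be the unique cycle in $T+e$. Then $(G,\rho)$ is walk-independent if and only if for every angle-preserving class $r$ and every $e\in E_G\setminus E_T$, traversing $C^T_e=(u_1,\dots,u_k)$ ($u_1=u_k$) gives $\sum(\rho(u_{i+1})-\rho(u_i))=(0,0)$, the sum over all $1\le i<k$ with $u_iu_{i+1}\in r$.
   Context: Graphs are simple and undirected. A placement of $G$ is $\rho:V_G\to\mathbb{R}^2$ with $\rho(u)\ne\rho(v)$ for edges $uv$; a parallelogram placement is an injective placement such that every induced 4-cycle forms a non-degenerate parallelogram (vertices not all collinear). Edges are in relation $\triangle$ if they lie in a common 3-cycle subgraph, and in relation $\square$ if they are opposite edges of a 4-cycle subgraph; angle-preserving classes are the equivalence classes of the reflexive-transitive closure of $\triangle\cup\square$ on $E_G$. $(G,\rho)$ is walk-independent if $\rho$ is a parallelogram placement and for every angle-preserving class $r$ and every closed walk $(u_1,\dots,u_k)$ in $G$ ($u_1=u_k$), $\sum(\rho(u_{i+1})-\rho(u_i))=(0,0)$ over all $1\le i<k$ with $u_iu_{i+1}\in r$. -}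

module Defs where

open import Level using (Level; _⊔_) renaming (suc to lsuc)
import Level
open import Algebra.Bundles using (CommutativeRing)
open import Data.Nat using (ℕ; _≤_)
open import Data.Fin using (Fin)
open import Data.List using (List; []; _∷_; length)
open import Data.List.Relation.Unary.AllPairs using (AllPairs)
open import Data.Product using (Σ; ∃; ∃-syntax; _×_; _,_)
open import Data.Sum using (_⊎_)
open import Relation.Nullary using (¬_; Dec; yes; no)
open import Relation.Binary.PropositionalEquality using (_≡_; _≢_)
open import Relation.Binary.Construct.Closure.ReflexiveTransitive using (Star)
open import Function.Bundles using (_⇔_)

record Field (c ℓ : Level) : Set (lsuc (c ⊔ ℓ)) where
  field
    commutativeRing : CommutativeRing c ℓ
  open CommutativeRing commutativeRing public
  field
    1≉0     : ¬ (1# ≈ 0#)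
    inverse : ∀ x → ¬ (x ≈ 0#) → ∃[ y ] (x * y ≈ 1#)

Rel : ℕ → Set₁
Rel n = Fin n → Fin n → Set

record Graph (n : ℕ) : Set₁ where
  field
    Adj    : Rel n
    sym    : ∀ {u v} → Adj u v → Adj v u
    irrefl : ∀ {u} → ¬ Adj u u
open Graph public

steps : ∀ {a} {A : Set a} → List A → List (A × A)
steps []           = []
steps (x ∷ [])     = []
steps (x ∷ y ∷ xs) = (x , y) ∷ steps (y ∷ xs)

data AllSteps {n : ℕ} (A : Rel n) : List (Fin n) → Set where
  nil  : AllSteps A []
  one  : ∀ x → AllSteps A (x ∷ [])
  cons : ∀ {x y xs} → A x y → AllSteps A (y ∷ xs) → AllSteps A (x ∷ y ∷ xs)

lastOr : ∀ {a} {A : Set a} → A → List A → A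
lastOr d []       = d
lastOr d (x ∷ xs) = lastOr x xs

IsWalk : ∀ {n} → Rel n → Fin n → Fin n → List (Fin n) → Set
IsWalk A u v []       = Data.Empty.⊥ where import Data.Empty
IsWalk A u v (x ∷ xs) = (x ≡ u) × (lastOr x xs ≡ v) × AllSteps A (x ∷ xs)

IsClosedWalk : ∀ {n} → Rel n → List (Fin n) → Set
IsClosedWalk A ws = ∃[ u ] IsWalk A u u ws

initList : ∀ {a} {A : Set a} → List A → List A
initList []           = []
initList (x ∷ [])     = []
initList (x ∷ y ∷ xs) = x ∷ initList (y ∷ xs)

IsCycle : ∀ {n} → Rel n → List (Fin n) → Set
IsCycle A ws = IsClosedWalk A ws × (4 ≤ length ws) × AllPairs _≢_ (initList ws)

Connected : ∀ {n} → Rel n → Set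
Connected {n} A = ∀ (u v : Fin n) → ∃[ ws ] IsWalk A u v ws

record SpanningTree {n : ℕ} (G : Graph n) (T : Rel n) : Set where
  field
    sub       : ∀ {u v} → T u v → Adj G u v
    symT      : ∀ {u v} → T u v → T v u
    connected : Connected T
    acyclic   : ∀ ws → ¬ IsCycle T ws

_+E_ : ∀ {n} → Rel n → Fin n × Fin n → Rel n
(T +E (a , b)) x y = T x y ⊎ ((x ≡ a × y ≡ b) ⊎ (x ≡ b × y ≡ a))

-- Angle-preserving classes.  Edges are represented as ordered pairs of
-- adjacent vertices; an undirected edge {a,b} corresponds to (a,b),(b,a).

module _ {n : ℕ} (G : Graph n) where

  SameEdge : Fin n × Fin n → Fin n × Fin n → Set
  SameEdge (a , b) (c , d) = (a ≡ c × b ≡ d) ⊎ (a ≡ d × b ≡ c)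

  Tri : Fin n × Fin n → Fin n × Fin n → Set
  Tri e f = ∃[ x ] ∃[ y ] ∃[ z ]
    (Adj G x y × Adj G y z × Adj G z x) ×
    (SameEdge e (x , y) ⊎ SameEdge e (y , z) ⊎ SameEdge e (z , x)) ×
    (SameEdge f (x , y) ⊎ SameEdge f (y , z) ⊎ SameEdge f (z , x))

  Sq : Fin n × Fin n → Fin n × Fin n → Set
  Sq e f = ∃[ x₁ ] ∃[ x₂ ] ∃[ x₃ ] ∃[ x₄ ]
    (x₁ ≢ x₃ × x₂ ≢ x₄) ×
    (Adj G x₁ x₂ × Adj G x₂ x₃ × Adj G x₃ x₄ × Adj G x₄ x₁) ×
    ((SameEdge e (x₁ , x₂) × SameEdge f (x₃ , x₄)) ⊎
     (SameEdge e (x₃ , x₄) × SameEdge f (x₁ , x₂)) ⊎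
     (SameEdge e (x₂ , x₃) × SameEdge f (x₄ , x₁)) ⊎
     (SameEdge e (x₄ , x₁) × SameEdge f (x₂ , x₃)))

  APStep : Fin n × Fin n → Fin n × Fin n → Set
  APStep e f = SameEdge e f ⊎ Tri e f ⊎ Sq e f

  AP : Fin n × Fin n → Fin n × Fin n → Set
  AP = Star APStep

  IsAPClass : Rel n → Set
  IsAPClass r = ∃[ a ] ∃[ b ] Adj G a b ×
    (∀ u v → r u v ⇔ (Adj G u v × AP (u , v) (a , b)))

module _ {c ℓ : Level} (K : Field c ℓ) where
  open Field K

  Pt : Set c
  Pt = Carrier × Carrier

  _≈²_ : Pt → Pt → Set ℓ
  (x , y) ≈² (x' , y') = (x ≈ x') × (y ≈ y')

  _+²_ : Pt → Pt → Pt
  (x , y) +² (x' , y') = (x + x' , y + y')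

  _-²_ : Pt → Pt → Pt
  (x , y) -² (x' , y') = (x - x' , y - y')

  0² : Pt
  0² = (0# , 0#)

  det : Pt → Pt → Carrier
  det (x , y) (x' , y') = x * y' - y * x'

  Collinear4 : Pt → Pt → Pt → Pt → Set ℓ
  Collinear4 p₁ p₂ p₃ p₄ =
    (det (p₂ -² p₁) (p₃ -² p₁) ≈ 0#) ×
    (det (p₂ -² p₁) (p₄ -² p₁) ≈ 0#) ×
    (det (p₃ -² p₁) (p₄ -² p₁) ≈ 0#)

  module _ {n : ℕ} (G : Graph n) (ρ : Fin n → Pt) where

    Induced4Cycle : Fin n → Fin n → Fin n → Fin n → Set
    Induced4Cycle x₁ x₂ x₃ x₄ =
      (Adj G x₁ x₂ × Adj G x₂ x₃ × Adj G x₃ x₄ × Adj G x₄ x₁) ×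
      (¬ Adj G x₁ x₃ × ¬ Adj G x₂ x₄) × (x₁ ≢ x₃ × x₂ ≢ x₄)

    IsParallelogramPlacement : Set ℓ
    IsParallelogramPlacement =
      (∀ u v → ρ u ≈² ρ v → u ≡ v) ×
      (∀ x₁ x₂ x₃ x₄ → Induced4Cycle x₁ x₂ x₃ x₄ →
         ((ρ x₂ -² ρ x₁) ≈² (ρ x₃ -² ρ x₄)) ×
         ¬ Collinear4 (ρ x₁) (ρ x₂) (ρ x₃) (ρ x₄))

    classSum : (r : Rel n) → (∀ u v → Dec (r u v)) → List (Fin n) → Pt
    classSum r dec ws = go (steps ws)
      where
      go : List (Fin n × Fin n) → Pt
      go [] = 0²
      go ((u , v) ∷ ps) with dec u v
      ... | yes _ = (ρ v -² ρ u) +² go ps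
      ... | no  _ = go ps

    WalkIndependent : Set (lsuc Level.zero ⊔ ℓ)
    WalkIndependent =
      IsParallelogramPlacement ×
      (∀ (r : Rel n) → IsAPClass G r → (dec : ∀ u v → Dec (r u v)) →
         ∀ ws → IsClosedWalk (Adj G) ws → classSum r dec ws ≈² 0²)

-- Weight each step uv of a walk by ρ v − ρ u if uv ∈ r and by 0 otherwise; the
-- weights are antisymmetric because r is closed under reversing edges. A closed
-- walk in the tree T then has sum 0: erasing its loops leaves the empty path, and
-- each erased loop is a backtrack, since T has no cycles. If every fundamental
-- cycle has sum 0, then the tree path between the ends of an edge uv of G has
-- the weight of uv as its sum, and replacing each step of a closed walk in G by
-- such a tree path gives a closed tree walk with the same sum.
module Submission where

open import Defs renaming (sym to Adj-sym)
import Level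
open import Level using (_⊔_)
open import Data.Nat using (ℕ; _≤_; s≤s)
open import Data.Nat.Properties using (m≤n+m)
open import Data.Fin using (Fin; _≟_)
open import Data.Product using (_×_; _,_; ∃-syntax)
open import Data.Sum using (inj₁; inj₂)
open import Data.Empty using (⊥-elim)
open import Data.List using (List; []; _∷_; _++_; [_]; length)
open import Data.List.Properties using (length-++)
open import Data.List.Relation.Unary.All using (All; []; _∷_)
import Data.List.Relation.Unary.All.Properties as All
open import Data.List.Relation.Unary.AllPairs using (AllPairs; []; _∷_)
open import Relation.Nullary using (¬_; Dec; yes; no)
open import Relation.Binary.PropositionalEquality
  using (_≡_; _≢_; refl; cong; subst) renaming (sym to ≡-sym; trans to ≡-trans)
open import Relation.Binary.Construct.Closure.ReflexiveTransitive using (_◅_)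
open import Function.Bundles using (_⇔_; mk⇔; Equivalence)
open import Algebra.Bundles using (Group; AbelianGroup)
open import Algebra.Construct.DirectProduct using (abelianGroup)

module _ {n : ℕ} where

  lastOr-++ : ∀ (x : Fin n) l m → lastOr x (l ++ m) ≡ lastOr (lastOr x l) m
  lastOr-++ x []      m = refl
  lastOr-++ x (y ∷ l) m = lastOr-++ y l m

  All-lastOr : ∀ {P : Fin n → Set} x l → All P (x ∷ l) → P (lastOr x l)
  All-lastOr x []      (px ∷ _)  = px
  All-lastOr x (y ∷ l) (_ ∷ pl) = All-lastOr y l pl

  AllSteps-map : ∀ {R R′ : Rel n} → (∀ {u v} → R u v → R′ u v) →
    ∀ {l} → AllSteps R l → AllSteps R′ l
  AllSteps-map f nil          = nil
  AllSteps-map f (one x)      = one x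
  AllSteps-map f (cons r rs) = cons (f r) (AllSteps-map f rs)

  AllSteps-++ : ∀ {R : Rel n} x l {y} m → lastOr x l ≡ y →
    AllSteps R (x ∷ l) → AllSteps R (y ∷ m) → AllSteps R (x ∷ l ++ m)
  AllSteps-++ x []      m refl _           rs′ = rs′
  AllSteps-++ x (y ∷ l) m eq   (cons r rs) rs′ = cons r (AllSteps-++ y l m eq rs rs′)

  AllSteps-++⁻ : ∀ {R : Rel n} x l z m → AllSteps R (x ∷ l ++ z ∷ m) →
    AllSteps R (x ∷ l ++ [ z ]) × AllSteps R (z ∷ m)
  AllSteps-++⁻ x []      z m (cons r rs) = cons r (one z) , rs
  AllSteps-++⁻ x (y ∷ l) z m (cons r rs) with AllSteps-++⁻ y l z m rs
  ... | rs₁ , rs₂ = cons r rs₁ , rs₂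

  AllPairs-++⁻ˡ : ∀ {P : Fin n → Fin n → Set} l m → AllPairs P (l ++ m) → AllPairs P l
  AllPairs-++⁻ˡ []      m _          = []
  AllPairs-++⁻ˡ (x ∷ l) m (px ∷ ps) = All.++⁻ˡ l px ∷ AllPairs-++⁻ˡ l m ps

  AllPairs-++⁻ʳ : ∀ {P : Fin n → Fin n → Set} l m → AllPairs P (l ++ m) → AllPairs P m
  AllPairs-++⁻ʳ []      m ps        = ps
  AllPairs-++⁻ʳ (x ∷ l) m (_ ∷ ps) = AllPairs-++⁻ʳ l m ps

  initList-∷ʳ : ∀ (x : Fin n) l z → initList (x ∷ l ++ [ z ]) ≡ x ∷ l
  initList-∷ʳ x []      z = refl
  initList-∷ʳ x (y ∷ l) z = cong (x ∷_) (initList-∷ʳ y l z)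

  closedPath⇒IsCycle : ∀ {R : Rel n} x z₁ z₂ p →
    AllSteps R (x ∷ z₁ ∷ z₂ ∷ p ++ [ x ]) → AllPairs _≢_ (x ∷ z₁ ∷ z₂ ∷ p) →
    IsCycle R (x ∷ z₁ ∷ z₂ ∷ p ++ [ x ])
  closedPath⇒IsCycle x z₁ z₂ p rs distinct =
    (x , refl , lastOr-++ x (z₁ ∷ z₂ ∷ p) [ x ] , rs) ,
    s≤s (s≤s (s≤s (subst (1 ≤_) (≡-sym (length-++ p)) (m≤n+m 1 (length p))))) ,
    subst (AllPairs _≢_) (≡-sym (initList-∷ʳ x (z₁ ∷ z₂ ∷ p) x)) distinct

  data FirstOccurrence (x : Fin n) : List (Fin n) → Set where
    absent  : ∀ {l} → All (x ≢_) l → FirstOccurrence x l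
    present : ∀ pre post → All (x ≢_) pre → FirstOccurrence x (pre ++ x ∷ post)

  firstOccurrence : ∀ x l → FirstOccurrence x l
  firstOccurrence x []      = absent []
  firstOccurrence x (y ∷ l) with x ≟ y
  ... | yes refl = present [] l []
  ... | no x≢y with firstOccurrence x l
  ...   | absent  x∉l            = absent (x≢y ∷ x∉l)
  ...   | present pre post x∉pre = present (y ∷ pre) post (x≢y ∷ x∉pre)

module WalkSum {n : ℕ} {a ℓ} (A : Group a ℓ) (w : Fin n → Fin n → Group.Carrier A) where
  open Group A renaming (refl to ≈-refl)

  walkSum : Fin n → List (Fin n) → Carrier
  walkSum x []       = ε
  walkSum x (y ∷ ys) = w x y ∙ walkSum y ys

  walkSum-++ : ∀ x l {y} m → lastOr x l ≡ y →
    walkSum x (l ++ m) ≈ walkSum x l ∙ walkSum y m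
  walkSum-++ x []      m refl = sym (identityˡ _)
  walkSum-++ x (y ∷ l) m eq   = trans (∙-congˡ (walkSum-++ y l m eq)) (sym (assoc _ _ _))

  walkSum-∷ʳ : ∀ x l z → walkSum x (l ++ [ z ]) ≈ walkSum x l ∙ w (lastOr x l) z
  walkSum-∷ʳ x l z = trans (walkSum-++ x l [ z ] refl) (∙-congˡ (identityʳ _))

  walkSum-split : ∀ x l z m → walkSum x (l ++ z ∷ m) ≈ walkSum x (l ++ [ z ]) ∙ walkSum z m
  walkSum-split x []      z m = ∙-congʳ (sym (identityʳ _))
  walkSum-split x (y ∷ l) z m = trans (∙-congˡ (walkSum-split y l z m)) (sym (assoc _ _ _))

module TreeWalks {n : ℕ} (G : Graph n) (T : Rel n) (tree : SpanningTree G T)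
  {a ℓ} (A : Group a ℓ) (w : Fin n → Fin n → Group.Carrier A)
  (w-anti : ∀ u v → Group._≈_ A (w v u) (Group._⁻¹ A (w u v))) where
  open Group A renaming (refl to ≈-refl)
  open import Algebra.Properties.Group A using (inverseˡ-unique)
  open SpanningTree tree
  open WalkSum A w

  -- a closed T-walk through distinct vertices is a backtrack x y x or a cycle of T
  closedTreePath-sum : ∀ x p → AllSteps T (x ∷ p ++ [ x ]) → AllPairs _≢_ (x ∷ p) →
    walkSum x (p ++ [ x ]) ≈ ε
  closedTreePath-sum x []            (cons t _) _ = ⊥-elim (irrefl G (sub t))
  closedTreePath-sum x (y ∷ [])      _          _ =
    trans (∙-congˡ (trans (identityʳ _) (w-anti x y))) (inverseʳ _)
  closedTreePath-sum x (z₁ ∷ z₂ ∷ p) rs distinct =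
    ⊥-elim (acyclic _ (closedPath⇒IsCycle x z₁ z₂ p rs distinct))

  record LoopErasure (x : Fin n) (ys : List (Fin n)) : Set ℓ where
    constructor loopErased
    field
      path      : List (Fin n)
      pathSteps : AllSteps T (x ∷ path)
      sameEnd   : lastOr x path ≡ lastOr x ys
      distinct  : AllPairs _≢_ (x ∷ path)
      sameSum   : walkSum x path ≈ walkSum x ys

  eraseLoopAt : ∀ x l → AllSteps T (x ∷ l) → AllPairs _≢_ l → FirstOccurrence x l →
    LoopErasure x l
  eraseLoopAt x l rs distinct (absent x∉l) = loopErased l rs refl (x∉l ∷ distinct) ≈-refl
  eraseLoopAt x .(pre ++ x ∷ post) rs distinct (present pre post x∉pre)
    with AllSteps-++⁻ x pre x post rs
  ... | loopSteps , postSteps =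
    loopErased post postSteps (≡-sym (lastOr-++ x pre (x ∷ post)))
      (AllPairs-++⁻ʳ pre (x ∷ post) distinct) (sym loopRemoved)
    where
    loop≈ε : walkSum x (pre ++ [ x ]) ≈ ε
    loop≈ε = closedTreePath-sum x pre loopSteps
               (x∉pre ∷ AllPairs-++⁻ˡ pre (x ∷ post) distinct)
    loopRemoved : walkSum x (pre ++ x ∷ post) ≈ walkSum x post
    loopRemoved = trans (walkSum-split x pre x post)
                    (trans (∙-congʳ loop≈ε) (identityˡ _))

  loopErase : ∀ x ys → AllSteps T (x ∷ ys) → LoopErasure x ys
  loopErase x []       rs          = loopErased [] rs refl ([] ∷ []) ≈-refl
  loopErase x (y ∷ ys) (cons t rs) with loopErase y ys rs
  ... | loopErased zs rs′ end distinct sum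
    with eraseLoopAt x (y ∷ zs) (cons t rs′) distinct (firstOccurrence x (y ∷ zs))
  ...   | loopErased zs′ rs″ end′ distinct′ sum′ =
    loopErased zs′ rs″ (≡-trans end′ end) distinct′ (trans sum′ (∙-congˡ sum))

  -- the loop erasure of a walk closed at x is empty, as x occurs only at its start
  closedTreeWalk-sum : ∀ x ys → AllSteps T (x ∷ ys) → lastOr x ys ≡ x → walkSum x ys ≈ ε
  closedTreeWalk-sum x ys rs closed with loopErase x ys rs
  ... | loopErased []       _ _   _            sum = sym sum
  ... | loopErased (z ∷ zs) _ end (x∉zs ∷ _) _   =
    ⊥-elim (All-lastOr z zs x∉zs (≡-sym (≡-trans end closed)))

  module _ (fundamental : ∀ u v → Adj G u v → ¬ T u v →
                          ∀ x p → IsCycle (T +E (u , v)) (x ∷ p) → walkSum x p ≈ ε) where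

    -- a path of T from x to y closes up with the edge yx to a cycle of T + yx,
    -- in particular yx ∉ T
    treePath-sum≈weight : ∀ x y → Adj G x y → ∀ p → AllSteps T (x ∷ p) → lastOr x p ≡ y →
      AllPairs _≢_ (x ∷ p) → walkSum x p ≈ w x y
    treePath-sum≈weight x y adj []       _ refl _ = ⊥-elim (irrefl G adj)
    treePath-sum≈weight x y adj (z ∷ []) _ refl _ = identityʳ _
    treePath-sum≈weight x y adj (z₁ ∷ z₂ ∷ q) rs refl distinct =
      trans (inverseˡ-unique _ _ cycle≈ε) (sym (w-anti y′ x))
      where
      p = z₁ ∷ z₂ ∷ q
      y′ = lastOr x p
      closingSteps : ∀ {R : Rel n} → (∀ {u v} → T u v → R u v) → R y′ x →
        AllSteps R (x ∷ p ++ [ x ])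
      closingSteps T⊆R r = AllSteps-++ x p [ x ] refl (AllSteps-map T⊆R rs) (cons r (one x))
      y′x∉T : ¬ T y′ x
      y′x∉T t = acyclic _ (closedPath⇒IsCycle x z₁ z₂ q (closingSteps (λ t → t) t) distinct)
      cycle≈ε : walkSum x p ∙ w y′ x ≈ ε
      cycle≈ε = trans (sym (walkSum-∷ʳ x p x))
        (fundamental y′ x (Adj-sym G adj) y′x∉T x _
          (closedPath⇒IsCycle x z₁ z₂ q (closingSteps inj₁ (inj₂ (inj₁ (refl , refl)))) distinct))

    treeWalk-sum≈weight : ∀ x y → Adj G x y → ∀ t → AllSteps T (x ∷ t) → lastOr x t ≡ y →
      walkSum x t ≈ w x y
    treeWalk-sum≈weight x y adj t rs end with loopErase x t rs
    ... | loopErased p rs′ end′ distinct sum =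
      trans (sym sum) (treePath-sum≈weight x y adj p rs′ (≡-trans end′ end) distinct)

    treeDetour : ∀ x ys → AllSteps (Adj G) (x ∷ ys) →
      ∃[ ts ] AllSteps T (x ∷ ts) × lastOr x ts ≡ lastOr x ys × walkSum x ts ≈ walkSum x ys
    treeDetour x []       _             = [] , one x , refl , ≈-refl
    treeDetour x (y ∷ ys) (cons adj rs) with connected x y | treeDetour y ys rs
    ... | (_ ∷ t) , refl , end , trs | ts , trs′ , end′ , sum =
      t ++ ts ,
      AllSteps-++ x t ts end trs trs′ ,
      ≡-trans (lastOr-++ x t ts) (≡-trans (cong (λ z → lastOr z ts) end) end′) ,
      trans (walkSum-++ x t ts end) (∙-cong (treeWalk-sum≈weight x y adj t trs end) sum)

    closedWalk-sum≈ε : ∀ x ys → IsClosedWalk (Adj G) (x ∷ ys) → walkSum x ys ≈ ε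
    closedWalk-sum≈ε x ys (_ , refl , closed , rs) with treeDetour x ys rs
    ... | ts , trs , end , sum = trans (sym sum) (closedTreeWalk-sum x ts trs (≡-trans end closed))

module _ {c ℓ} (K : Field c ℓ) where
  open Field K using (+-abelianGroup)

  -- (K², +) as a direct product; its _≈_, _∙_ and ε unfold to _≈²_, _+²_ and 0²
  pointGroup : AbelianGroup c ℓ
  pointGroup = abelianGroup +-abelianGroup +-abelianGroup

  module ClassWeight {n : ℕ} (G : Graph n) (ρ : Fin n → Pt K)
    (r : Rel n) (dec : ∀ u v → Dec (r u v)) where
    open AbelianGroup pointGroup renaming (refl to ≈-refl)
    open import Algebra.Properties.AbelianGroup pointGroup using (⁻¹-anti-homo‿-)
    open import Algebra.Properties.Group group using (ε⁻¹≈ε)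

    classWeight : Fin n → Fin n → Pt K
    classWeight u v with dec u v
    ... | yes _ = _-²_ K (ρ v) (ρ u)
    ... | no  _ = 0² K

    classWeight-anti : (∀ {u v} → r u v → r v u) →
      ∀ u v → classWeight v u ≈ classWeight u v ⁻¹
    classWeight-anti r-sym u v with dec u v | dec v u
    ... | yes _   | yes _   = sym (⁻¹-anti-homo‿- (ρ v) (ρ u))
    ... | no  _   | no  _   = sym ε⁻¹≈ε
    ... | yes ruv | no ¬rvu = ⊥-elim (¬rvu (r-sym ruv))
    ... | no ¬ruv | yes rvu = ⊥-elim (¬ruv (r-sym rvu))

    open WalkSum group classWeight

    classSum≈walkSum : ∀ x p → _≈²_ K (classSum K G ρ r dec (x ∷ p)) (walkSum x p)
    classSum≈walkSum x []      = ≈-refl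
    classSum≈walkSum x (y ∷ p) with dec x y
    ... | yes _ = ∙-congˡ (classSum≈walkSum y p)
    ... | no  _ = trans (classSum≈walkSum y p) (sym (identityˡ _))

IsAPClass-sym : ∀ {n} (G : Graph n) {r : Rel n} → IsAPClass G r → ∀ {u v} → r u v → r v u
IsAPClass-sym G {r} (_ , _ , _ , r⇔AP) {u} {v} ruv with Equivalence.to (r⇔AP u v) ruv
... | adj , ap = Equivalence.from (r⇔AP v u) (Adj-sym G adj , inj₁ (inj₂ (refl , refl)) ◅ ap)

+E-⊆-Adj : ∀ {n} (G : Graph n) {T : Rel n} → (∀ {u v} → T u v → Adj G u v) →
  ∀ {a b} → Adj G a b → ∀ {u v} → (T +E (a , b)) u v → Adj G u v
+E-⊆-Adj G T⊆G adj (inj₁ t)                   = T⊆G t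
+E-⊆-Adj G T⊆G adj (inj₂ (inj₁ (refl , refl))) = adj
+E-⊆-Adj G T⊆G adj (inj₂ (inj₂ (refl , refl))) = Adj-sym G adj

module _ {c ℓ} (K : Field c ℓ) {n : ℕ} (G : Graph n) (ρ : Fin n → Pt K) where

  FundamentalCycleSums≈0 : Rel n → Set (Level.suc Level.zero ⊔ ℓ)
  FundamentalCycleSums≈0 T =
    ∀ (r : Rel n) → IsAPClass G r → (dec : ∀ u v → Dec (r u v)) →
    ∀ a b → Adj G a b → ¬ T a b →
    ∀ ws → IsCycle (T +E (a , b)) ws → _≈²_ K (classSum K G ρ r dec ws) (0² K)

  walkIndependent⇒fundamentalCycleSums≈0 : ∀ {T} → SpanningTree G T →
    WalkIndependent K G ρ → FundamentalCycleSums≈0 T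
  walkIndependent⇒fundamentalCycleSums≈0 tree (_ , independent)
    r class dec a b adj _ (x ∷ p) ((u , start , end , rs) , _) =
    independent r class dec (x ∷ p)
      (u , start , end , AllSteps-map (+E-⊆-Adj G (SpanningTree.sub tree) adj) rs)

  fundamentalCycleSums≈0⇒walkIndependent : ∀ {T} → SpanningTree G T →
    IsParallelogramPlacement K G ρ → FundamentalCycleSums≈0 T → WalkIndependent K G ρ
  fundamentalCycleSums≈0⇒walkIndependent {T} tree placement balanced =
    placement , closedWalkSums≈0
    where
    closedWalkSums≈0 : ∀ r → IsAPClass G r → (dec : ∀ u v → Dec (r u v)) →
      ∀ ws → IsClosedWalk (Adj G) ws → _≈²_ K (classSum K G ρ r dec ws) (0² K)
    closedWalkSums≈0 r class dec (x ∷ ys) closed =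
      trans (classSum≈walkSum x ys)
        (TreeWalks.closedWalk-sum≈ε G T tree group classWeight
          (classWeight-anti (IsAPClass-sym G class)) fundamental x ys closed)
      where
      open ClassWeight K G ρ r dec
      open AbelianGroup (pointGroup K)
      open WalkSum group classWeight
      fundamental : ∀ u v → Adj G u v → ¬ T u v →
        ∀ x p → IsCycle (T +E (u , v)) (x ∷ p) → walkSum x p ≈ ε
      fundamental u v adj u∉T x p cycle =
        trans (sym (classSum≈walkSum x p)) (balanced r class dec u v adj u∉T (x ∷ p) cycle)

propositionA1 : ∀ {c ℓ} (K : Field c ℓ) (n : ℕ) (G : Graph n)
    (ρ : Fin n → Pt K) (T : Rel n) →
    Connected (Adj G) →
    IsParallelogramPlacement K G ρ →
    SpanningTree G T →
    WalkIndependent K G ρ ⇔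
      (∀ (r : Rel n) → IsAPClass G r → (dec : ∀ u v → Dec (r u v)) →
         ∀ a b → Adj G a b → ¬ T a b →
         ∀ ws → IsCycle (T +E (a , b)) ws →
         _≈²_ K (classSum K G ρ r dec ws) (0² K))
-- connectivity of G already follows from that of the spanning tree
propositionA1 K n G ρ T _ placement tree =
  mk⇔ (walkIndependent⇒fundamentalCycleSums≈0 K G ρ tree)
      (fundamentalCycleSums≈0⇒walkIndependent K G ρ tree placement)
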